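{- Let $T$ be a tournament and let $M$ be a minimal co-module of $T$. Then $o_T(M) \leq 2$. Moreover, if $M$ is not a module of $T$ of cardinality $2$, then $o_T(M) = 0$.
   Context: A tournament $T$ is a finite vertex set $V(T)$ with an arc set $A(T)$ such that for all distinct $x,y$, exactly one of $(x,y),(y,x)$ lies in $A(T)$. A module of $T$ is a subset $M \subseteq V(T)$ such that for all $x,y \in M$ and $v \notin M$, $(v,x)\in A(T)$ iff $(v,y)\in A(T)$; trivial modules are $\emptyset$, singletons and $V(T)$. With $\overline{X} = V(T)\setminus X$, a co-module of $T$ is a set $M$ such that $M$ or $\overline{M}$ is a nontrivial module. A minimal co-module is a co-module containing no other co-module; ${\rm mc}(T)$ is the set of minimal co-modules. Two sets overlap if their intersection and both differences are nonempty. For $M \in {\rm mc}(T)$, $O_T(M)$ is the set of $N \in {\rm mc}(T)$ overlapping $M$, and $o_T(M) = |O_T(M)|$. -}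

module Defs where

open import Data.Nat using (ℕ)
open import Data.Fin using (Fin)
open import Data.Fin.Subset using (Subset; _∈_; _∉_; _⊆_; _∩_; _─_; ∁; ⊤; ∣_∣; Nonempty)
open import Data.Product using (_×_; Σ)
open import Data.Sum using (_⊎_)
open import Relation.Nullary using (¬_)
open import Relation.Binary.PropositionalEquality using (_≡_; _≢_)
open import Function.Bundles using (_⇔_)

record Tournament : Set₁ where
  field
    n          : ℕ
    arc        : Fin n → Fin n → Set
    loopless   : ∀ x → ¬ arc x x
    total      : ∀ x y → x ≢ y → arc x y ⊎ arc y x
    asymmetric : ∀ x y → ¬ (arc x y × arc y x)

module _ (T : Tournament) where
  open Tournament T

  IsModule : Subset n → Set
  IsModule M = ∀ x y v → x ∈ M → y ∈ M → v ∉ M → (arc v x ⇔ arc v y)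

  IsTrivial : Subset n → Set
  IsTrivial M = (∣ M ∣ ≡ 0) ⊎ (∣ M ∣ ≡ 1) ⊎ (M ≡ ⊤)

  IsNontrivialModule : Subset n → Set
  IsNontrivialModule M = IsModule M × ¬ IsTrivial M

  IsCoModule : Subset n → Set
  IsCoModule M = IsNontrivialModule M ⊎ IsNontrivialModule (∁ M)

  IsMinimalCoModule : Subset n → Set
  IsMinimalCoModule M = IsCoModule M × (∀ N → IsCoModule N → N ⊆ M → N ≡ M)

  Overlap : Subset n → Subset n → Set
  Overlap M N = Nonempty (M ∩ N) × Nonempty (M ─ N) × Nonempty (N ─ M)

  InO : Subset n → Subset n → Set
  InO M N = IsMinimalCoModule N × Overlap M N

module Submission where

-- Main lemma (overlap⇒pairModule): if a minimal co-module M is overlapped by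
-- a minimal co-module N, then M is a module with two vertices.  N (or its
-- complement) is a module V overlapping M.  If M is a module, M ∩ V and M ─ V
-- are modules properly inside M, so minimality makes both singletons.  If ∁M
-- is a nontrivial module, V ∪ ∁M is a nontrivial module whose complement is a
-- co-module strictly inside M, which is impossible.
--
-- Applied symmetrically, every N overlapping M is a two-vertex module too.
-- Three distinct two-vertex modules of a tournament never share a vertex
-- (sunflower), so distinct overlapping N, N′ meet M in different vertices;
-- as |M| = 2, at most two co-modules overlap M.

open import Defs
open import Data.Nat using (_≤_)
open import Data.List using (List; length)
open import Data.List.Relation.Unary.All using (All)
open import Data.List.Relation.Unary.Unique.Propositional using (Unique)
open import Data.Fin.Subset using (Subset; ∣_∣)
open import Data.Product using (_×_)
open import Relation.Nullary using (¬_)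
open import Relation.Binary.PropositionalEquality using (_≡_)

open import Level using (0ℓ)
open import Data.Nat using (zero; suc; _+_; z≤n; s≤s)
open import Data.Nat.Properties using (+-suc; ≤-trans; <-≤-trans; ≤-reflexive) renaming (_≟_ to _≟ℕ_)
open import Data.Bool using (true; false)
open import Data.Vec using ([]; _∷_; here; there)
open import Data.List using ([]; _∷_)
open import Data.Fin as Fin using (Fin)
open import Data.Fin.Properties using (_≟_)
open import Data.Fin.Subset using (_∈_; _∉_; _⊆_; _∩_; _∪_; _─_; _-_; ∁; ⁅_⁆; Nonempty)
open import Data.Fin.Subset.Properties
open import Data.Product using (∃; _,_; proj₁; proj₂)
open import Data.Sum using (_⊎_; inj₁; inj₂)
open import Data.Empty using (⊥; ⊥-elim)
open import Data.List.Relation.Unary.All using (_∷_)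
open import Data.List.Relation.Unary.AllPairs using (_∷_)
open import Relation.Nullary using (yes; no; contradiction)
open import Relation.Binary.PropositionalEquality using (refl; sym; trans; cong; cong₂; subst; _≢_)
open import Function.Bundles using (_⇔_; mk⇔; Equivalence)
open import Function.Properties.Equivalence using (⇔-setoid)
import Function.Properties.Equivalence as ⇔
open import Function using (_∘_)
import Relation.Binary.Reasoning.Setoid as SetoidReasoning

∁-involutive : ∀ {n} (p : Subset n) → ∁ (∁ p) ≡ p
∁-involutive []          = refl
∁-involutive (true ∷ p)  = cong (true ∷_) (∁-involutive p)
∁-involutive (false ∷ p) = cong (false ∷_) (∁-involutive p)

x∈p─q⁻ : ∀ {n} {x : Fin n} (p q : Subset n) → x ∈ p ─ q → x ∈ p × x ∉ q
x∈p─q⁻ {x = Fin.zero}  (true  ∷ p) (false ∷ q) here       = here , λ ()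
x∈p─q⁻ {x = Fin.zero}  (true  ∷ p) (true  ∷ q) ()
x∈p─q⁻ {x = Fin.zero}  (false ∷ p) (true  ∷ q) ()
x∈p─q⁻ {x = Fin.zero}  (false ∷ p) (false ∷ q) ()
x∈p─q⁻ {x = Fin.suc x} (_     ∷ p) (_     ∷ q) (there x∈) with x∈p─q⁻ p q x∈
... | x∈p , x∉q = there x∈p , λ { (there x∈q) → x∉q x∈q }

∣p∣≡∣p∩q∣+∣p─q∣ : ∀ {n} (p q : Subset n) → ∣ p ∣ ≡ ∣ p ∩ q ∣ + ∣ p ─ q ∣
∣p∣≡∣p∩q∣+∣p─q∣ []          []          = refl
∣p∣≡∣p∩q∣+∣p─q∣ (true ∷ p)  (true ∷ q)  = cong suc (∣p∣≡∣p∩q∣+∣p─q∣ p q)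
∣p∣≡∣p∩q∣+∣p─q∣ (true ∷ p)  (false ∷ q) =
  trans (cong suc (∣p∣≡∣p∩q∣+∣p─q∣ p q)) (sym (+-suc _ _))
∣p∣≡∣p∩q∣+∣p─q∣ (false ∷ p) (true ∷ q)  = ∣p∣≡∣p∩q∣+∣p─q∣ p q
∣p∣≡∣p∩q∣+∣p─q∣ (false ∷ p) (false ∷ q) = ∣p∣≡∣p∩q∣+∣p─q∣ p q

∈∉⇒≢ : ∀ {n} {x y : Fin n} {p : Subset n} → x ∈ p → y ∉ p → x ≢ y
∈∉⇒≢ {p = p} x∈p y∉p x≡y = y∉p (subst (_∈ p) x≡y x∈p)

¬Nonempty[p─q]⇒p⊆q : ∀ {n} {p q : Subset n} → ¬ Nonempty (p ─ q) → p ⊆ q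
¬Nonempty[p─q]⇒p⊆q {q = q} p─q-empty {x} x∈p with x ∈? q
... | yes x∈q = x∈q
... | no x∉q  = ⊥-elim (p─q-empty (x , x∈p∧x∉q⇒x∈p─q x∈p x∉q))

x∈p⇒1≤∣p∣ : ∀ {n} {x : Fin n} {p : Subset n} → x ∈ p → 1 ≤ ∣ p ∣
x∈p⇒1≤∣p∣ {x = x} {p} x∈p = subst (_≤ ∣ p ∣) (∣⁅x⁆∣≡1 x)
  (p⊆q⇒∣p∣≤∣q∣ λ y∈⁅x⁆ → subst (_∈ p) (sym (x∈⁅y⁆⇒x≡y _ y∈⁅x⁆)) x∈p)

two-element : ∀ {n} {x y z : Fin n} {p : Subset n} →
  ∣ p ∣ ≡ 2 → x ∈ p → y ∈ p → x ≢ y → z ∈ p → z ≡ x ⊎ z ≡ y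
two-element {x = x} {y} {z} {p} ∣p∣≡2 x∈p y∈p x≢y z∈p with z ≟ x | z ≟ y
... | yes z≡x | _       = inj₁ z≡x
... | no _    | yes z≡y = inj₂ z≡y
... | no z≢x  | no z≢y  = contradiction (≤-trans 3≤∣p∣ (≤-reflexive ∣p∣≡2)) λ { (s≤s (s≤s ())) }
  where
  y∈p-x : y ∈ p - x
  y∈p-x = x∈p∧x≢y⇒x∈p-y y∈p (λ y≡x → x≢y (sym y≡x))
  z∈p-x-y : z ∈ p - x - y
  z∈p-x-y = x∈p∧x≢y⇒x∈p-y (x∈p∧x≢y⇒x∈p-y z∈p z≢x) z≢y
  3≤∣p∣ : 3 ≤ ∣ p ∣
  3≤∣p∣ = <-≤-trans (s≤s (<-≤-trans (s≤s (x∈p⇒1≤∣p∣ z∈p-x-y)) (x∈p⇒∣p-x∣<∣p∣ y∈p-x)))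
                    (x∈p⇒∣p-x∣<∣p∣ x∈p)

partner : ∀ {n} {a : Fin n} {p : Subset n} → ∣ p ∣ ≡ 2 → a ∈ p → ∃ λ x → x ∈ p × x ≢ a
partner {a = a} {p} ∣p∣≡2 a∈p with nonempty? (p - a)
... | yes (x , x∈p-a) = x , proj₁ (x∈p─q⁻ p ⁅ a ⁆ x∈p-a) , x∉⁅y⁆⇒x≢y (proj₂ (x∈p─q⁻ p ⁅ a ⁆ x∈p-a))
... | no p-a-empty = contradiction (subst (_≤ 1) ∣p∣≡2 ∣p∣≤1) λ { (s≤s ()) }
  where
  p⊆⁅a⁆ : p ⊆ ⁅ a ⁆
  p⊆⁅a⁆ {y} y∈p with y ≟ a
  ... | yes y≡a = subst (_∈ ⁅ a ⁆) (sym y≡a) (x∈⁅x⁆ a)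
  ... | no y≢a  = ⊥-elim (p-a-empty (y , x∈p∧x≢y⇒x∈p-y y∈p y≢a))
  ∣p∣≤1 : ∣ p ∣ ≤ 1
  ∣p∣≤1 = subst (∣ p ∣ ≤_) (∣⁅x⁆∣≡1 a) (p⊆q⇒∣p∣≤∣q∣ p⊆⁅a⁆)

pair⊆ : ∀ {n} {a x : Fin n} {p q : Subset n} →
  ∣ p ∣ ≡ 2 → a ∈ p → x ∈ p → a ≢ x → a ∈ q → x ∈ q → p ⊆ q
pair⊆ ∣p∣≡2 a∈p x∈p a≢x a∈q x∈q z∈p with two-element ∣p∣≡2 a∈p x∈p a≢x z∈p
... | inj₁ z≡a = subst (_∈ _) (sym z≡a) a∈q
... | inj₂ z≡x = subst (_∈ _) (sym z≡x) x∈q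

partner∉ : ∀ {n} {a x : Fin n} {p q : Subset n} →
  ∣ p ∣ ≡ 2 → ∣ q ∣ ≡ 2 → a ∈ p → x ∈ p → x ≢ a → a ∈ q → p ≢ q → x ∉ q
partner∉ ∣p∣≡2 ∣q∣≡2 a∈p x∈p x≢a a∈q p≢q x∈q =
  p≢q (⊆-antisym (pair⊆ ∣p∣≡2 a∈p x∈p a≢x a∈q x∈q) (pair⊆ ∣q∣≡2 a∈q x∈q a≢x a∈p x∈p))
  where
  a≢x : _ ≢ _
  a≢x a≡x = x≢a (sym a≡x)

pigeonhole : ∀ {n} {x y z : Fin n} {p : Subset n} →
  ∣ p ∣ ≡ 2 → x ∈ p → y ∈ p → z ∈ p → x ≡ y ⊎ x ≡ z ⊎ y ≡ z
pigeonhole {x = x} {y} ∣p∣≡2 x∈p y∈p z∈p with x ≟ y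
... | yes x≡y = inj₁ x≡y
... | no x≢y with two-element ∣p∣≡2 x∈p y∈p x≢y z∈p
...   | inj₁ z≡x = inj₂ (inj₁ (sym z≡x))
...   | inj₂ z≡y = inj₂ (inj₂ (sym z≡y))

≢0≢1⇒2≤ : ∀ {m} → m ≢ 0 → m ≢ 1 → 2 ≤ m
≢0≢1⇒2≤ {zero}        m≢0 _   = contradiction refl m≢0
≢0≢1⇒2≤ {suc zero}    _   m≢1 = contradiction refl m≢1
≢0≢1⇒2≤ {suc (suc m)} _   _   = s≤s (s≤s z≤n)

¬-cong : ∀ {A B : Set} → A ⇔ B → (¬ A) ⇔ (¬ B)
¬-cong A⇔B = mk⇔ (λ ¬a b → ¬a (Equivalence.from A⇔B b)) (λ ¬b a → ¬b (Equivalence.to A⇔B a))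

module _ (T : Tournament) where
  open Tournament T
  open Equivalence
  open SetoidReasoning (⇔-setoid 0ℓ)

  arc⇔¬arc : ∀ {u v} → u ≢ v → arc u v ⇔ (¬ arc v u)
  arc⇔¬arc {u} {v} u≢v = mk⇔ (λ uv vu → asymmetric u v (uv , vu)) one-of
    where
    one-of : ¬ arc v u → arc u v
    one-of ¬vu with total u v u≢v
    ... | inj₁ uv = uv
    ... | inj₂ vu = ⊥-elim (¬vu vu)

  ¬arc⇔reverse : ∀ {u v} → u ≢ v → ¬ (arc u v ⇔ arc v u)
  ¬arc⇔reverse {u} {v} u≢v uv⇔vu with total u v u≢v
  ... | inj₁ uv = asymmetric u v (uv , to uv⇔vu uv)
  ... | inj₂ vu = asymmetric u v (from uv⇔vu vu , vu)

  module-outArcs : ∀ {Y a b w} → IsModule T Y → a ∈ Y → b ∈ Y → w ∉ Y → arc a w ⇔ arc b w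
  module-outArcs {a = a} {b} {w} mY a∈Y b∈Y w∉Y = begin
    arc a w    ≈⟨ arc⇔¬arc (∈∉⇒≢ a∈Y w∉Y) ⟩
    ¬ arc w a  ≈⟨ ¬-cong (mY a b w a∈Y b∈Y w∉Y) ⟩
    ¬ arc w b  ≈⟨ arc⇔¬arc (∈∉⇒≢ b∈Y w∉Y) ⟨
    arc b w    ∎

  ∩-module : ∀ {X Y} → IsModule T X → IsModule T Y → IsModule T (X ∩ Y)
  ∩-module {X} {Y} mX mY x y v x∈X∩Y y∈X∩Y v∉X∩Y
    with x∈p∩q⁻ X Y x∈X∩Y | x∈p∩q⁻ X Y y∈X∩Y | v ∈? X
  ... | _ , x∈Y | _ , y∈Y | yes v∈X = mY x y v x∈Y y∈Y (λ v∈Y → v∉X∩Y (x∈p∩q⁺ (v∈X , v∈Y)))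
  ... | x∈X , _ | y∈X , _ | no v∉X  = mX x y v x∈X y∈X v∉X

  ∪-module : ∀ {X Y} → IsModule T X → IsModule T Y → Nonempty (X ∩ Y) → IsModule T (X ∪ Y)
  ∪-module {X} {Y} mX mY (z , z∈X∩Y) x y v x∈X∪Y y∈X∪Y v∉X∪Y =
    ⇔.trans (towards-z x x∈X∪Y) (⇔.sym (towards-z y y∈X∪Y))
    where
    towards-z : ∀ w → w ∈ X ∪ Y → arc v w ⇔ arc v z
    towards-z w w∈X∪Y with x∈p∪q⁻ X Y w∈X∪Y
    ... | inj₁ w∈X = mX w z v w∈X (proj₁ (x∈p∩q⁻ X Y z∈X∩Y)) (v∉X∪Y ∘ x∈p∪q⁺ ∘ inj₁)
    ... | inj₂ w∈Y = mY w z v w∈Y (proj₂ (x∈p∩q⁻ X Y z∈X∩Y)) (v∉X∪Y ∘ x∈p∪q⁺ ∘ inj₂)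

  -- X ─ Y is a module when Y ─ X is nonempty: a vertex of X ∩ Y sees X ─ Y like a
  -- vertex z of Y ─ X does, and z sees all of X alike.
  ─-module : ∀ {X Y} → IsModule T X → IsModule T Y → Nonempty (Y ─ X) → IsModule T (X ─ Y)
  ─-module {X} {Y} mX mY (z , z∈Y─X) x y v x∈X─Y y∈X─Y v∉X─Y
    with x∈p─q⁻ X Y x∈X─Y | x∈p─q⁻ X Y y∈X─Y | x∈p─q⁻ Y X z∈Y─X | v ∈? X
  ... | x∈X , _ | y∈X , _ | _ | no v∉X = mX x y v x∈X y∈X v∉X
  ... | x∈X , x∉Y | y∈X , y∉Y | z∈Y , z∉X | yes v∈X = begin
    arc v x  ≈⟨ module-outArcs mY v∈Y z∈Y x∉Y ⟩
    arc z x  ≈⟨ mX x y z x∈X y∈X z∉X ⟩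
    arc z y  ≈⟨ module-outArcs mY v∈Y z∈Y y∉Y ⟨
    arc v y  ∎
    where
    v∈Y : v ∈ Y
    v∈Y with v ∈? Y
    ... | yes v∈Y = v∈Y
    ... | no v∉Y  = ⊥-elim (v∉X─Y (x∈p∧x∉q⇒x∈p─q v∈X v∉Y))

  ¬trivial : ∀ {A w} → 2 ≤ ∣ A ∣ → w ∉ A → ¬ IsTrivial T A
  ¬trivial 2≤∣A∣ _ (inj₁ ∣A∣≡0)         = contradiction (subst (2 ≤_) ∣A∣≡0 2≤∣A∣) λ ()
  ¬trivial 2≤∣A∣ _ (inj₂ (inj₁ ∣A∣≡1))  = contradiction (subst (2 ≤_) ∣A∣≡1 2≤∣A∣) λ { (s≤s ()) }
  ¬trivial {w = w} _ w∉A (inj₂ (inj₂ A≡⊤)) = w∉A (subst (w ∈_) (sym A≡⊤) ∈⊤)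

  nontrivial⇒2≤∣A∣ : ∀ {A} → ¬ IsTrivial T A → 2 ≤ ∣ A ∣
  nontrivial⇒2≤∣A∣ nontrivial = ≢0≢1⇒2≤ (nontrivial ∘ inj₁) (nontrivial ∘ inj₂ ∘ inj₁)

  ∁-coModule : ∀ {U} → IsNontrivialModule T U → IsCoModule T (∁ U)
  ∁-coModule {U} ntU = inj₂ (subst (IsNontrivialModule T) (sym (∁-involutive U)) ntU)

  crossArcs : ∀ {X Y a x y} → IsModule T X → IsModule T Y →
    a ∈ X → a ∈ Y → x ∈ X → x ∉ Y → y ∈ Y → y ∉ X → arc a y ⇔ arc x a
  crossArcs {a = a} {x} {y} mX mY a∈X a∈Y x∈X x∉Y y∈Y y∉X = begin
    arc a y    ≈⟨ arc⇔¬arc (∈∉⇒≢ a∈X y∉X) ⟩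
    ¬ arc y a  ≈⟨ ¬-cong (mX a x y a∈X x∈X y∉X) ⟩
    ¬ arc y x  ≈⟨ arc⇔¬arc (∈∉⇒≢ x∈X y∉X) ⟨
    arc x y    ≈⟨ mY a y x a∈Y y∈Y x∉Y ⟨
    arc x a    ∎

  -- Sunflower lemma: three distinct two-vertex modules never share a vertex a.
  -- With partners x, y, z of a, crossArcs would orient the arc a–z both ways.
  sunflower : ∀ {X Y Z a} → IsModule T X → IsModule T Y → IsModule T Z →
    ∣ X ∣ ≡ 2 → ∣ Y ∣ ≡ 2 → ∣ Z ∣ ≡ 2 → a ∈ X → a ∈ Y → a ∈ Z →
    X ≢ Y → X ≢ Z → Y ≢ Z → ⊥
  sunflower {X} {Y} {Z} {a} mX mY mZ ∣X∣≡2 ∣Y∣≡2 ∣Z∣≡2 a∈X a∈Y a∈Z X≢Y X≢Z Y≢Z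
    with partner ∣X∣≡2 a∈X | partner ∣Y∣≡2 a∈Y | partner ∣Z∣≡2 a∈Z
  ... | x , x∈X , x≢a | y , y∈Y , y≢a | z , z∈Z , z≢a =
    ¬arc⇔reverse (λ a≡z → z≢a (sym a≡z)) (begin
      arc a z  ≈⟨ crossArcs mX mZ a∈X a∈Z x∈X x∉Z z∈Z z∉X ⟩
      arc x a  ≈⟨ crossArcs mX mY a∈X a∈Y x∈X x∉Y y∈Y y∉X ⟨
      arc a y  ≈⟨ crossArcs mZ mY a∈Z a∈Y z∈Z z∉Y y∈Y y∉Z ⟩
      arc z a  ∎)
    where
    x∉Y : x ∉ Y
    x∉Y = partner∉ ∣X∣≡2 ∣Y∣≡2 a∈X x∈X x≢a a∈Y X≢Y
    x∉Z : x ∉ Z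
    x∉Z = partner∉ ∣X∣≡2 ∣Z∣≡2 a∈X x∈X x≢a a∈Z X≢Z
    y∉X : y ∉ X
    y∉X = partner∉ ∣Y∣≡2 ∣X∣≡2 a∈Y y∈Y y≢a a∈X (X≢Y ∘ sym)
    y∉Z : y ∉ Z
    y∉Z = partner∉ ∣Y∣≡2 ∣Z∣≡2 a∈Y y∈Y y≢a a∈Z Y≢Z
    z∉X : z ∉ X
    z∉X = partner∉ ∣Z∣≡2 ∣X∣≡2 a∈Z z∈Z z≢a a∈X (X≢Z ∘ sym)
    z∉Y : z ∉ Y
    z∉Y = partner∉ ∣Z∣≡2 ∣Y∣≡2 a∈Z z∈Z z≢a a∈Y (Y≢Z ∘ sym)

  OverlapWitnesses : Subset n → Subset n → Set
  OverlapWitnesses M N =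
    ∃ λ a → ∃ λ b → ∃ λ c → (a ∈ M × a ∈ N) × (b ∈ M × b ∉ N) × (c ∈ N × c ∉ M)

  overlap⁻ : ∀ {M N} → Overlap T M N → OverlapWitnesses M N
  overlap⁻ {M} {N} ((a , a∈M∩N) , (b , b∈M─N) , (c , c∈N─M)) =
    a , b , c , x∈p∩q⁻ M N a∈M∩N , x∈p─q⁻ M N b∈M─N , x∈p─q⁻ N M c∈N─M

  overlap⁺ : ∀ {M N} → OverlapWitnesses M N → Overlap T M N
  overlap⁺ (a , b , c , a∈M∩N , (b∈M , b∉N) , (c∈N , c∉M)) =
    (a , x∈p∩q⁺ a∈M∩N) , (b , x∈p∧x∉q⇒x∈p─q b∈M b∉N) , (c , x∈p∧x∉q⇒x∈p─q c∈N c∉M)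

  overlap-sym : ∀ {M N} → Overlap T M N → Overlap T N M
  overlap-sym ov with overlap⁻ ov
  ... | a , b , c , (a∈M , a∈N) , b∈M─N , c∈N─M = overlap⁺ (a , c , b , (a∈N , a∈M) , c∈N─M , b∈M─N)

  overlap⇒≢ : ∀ {M N} → Overlap T M N → M ≢ N
  overlap⇒≢ ov M≡N with overlap⁻ ov
  ... | _ , b , _ , _ , (b∈M , b∉N) , _ = b∉N (subst (_ ∈_) M≡N b∈M)

  minimal-shrink : ∀ {M N} → IsMinimalCoModule T M → IsCoModule T N → N ⊆ M → N ≡ M
  minimal-shrink (_ , minimal) coN N⊆M = minimal _ coN N⊆M

  proper-submodule-singleton : ∀ {M A p q} → IsMinimalCoModule T M → IsModule T A → A ⊆ M →
    p ∈ A → q ∈ M → q ∉ A → ∣ A ∣ ≡ 1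
  proper-submodule-singleton {M} {A} {q = q} minM mA A⊆M p∈A q∈M q∉A with ∣ A ∣ ≟ℕ 1
  ... | yes ∣A∣≡1 = ∣A∣≡1
  ... | no ∣A∣≢1  = ⊥-elim (q∉A (subst (q ∈_) (sym A≡M) q∈M))
    where
    nontrivial : ¬ IsTrivial T A
    nontrivial (inj₁ ∣A∣≡0)         = contradiction (subst (1 ≤_) ∣A∣≡0 (x∈p⇒1≤∣p∣ p∈A)) λ ()
    nontrivial (inj₂ (inj₁ ∣A∣≡1))  = ∣A∣≢1 ∣A∣≡1
    nontrivial (inj₂ (inj₂ A≡⊤))    = q∉A (subst (q ∈_) (sym A≡⊤) ∈⊤)
    A≡M : A ≡ M
    A≡M = minimal-shrink minM (inj₁ (mA , nontrivial)) A⊆M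

  ∁-escapes : ∀ {M N e} → IsMinimalCoModule T M → IsNontrivialModule T (∁ N) →
    e ∈ M → e ∈ N → ∃ λ c → c ∈ ∁ N × c ∉ M
  ∁-escapes {M} {N} {e} minM ntN̄ e∈M e∈N with nonempty? (∁ N ─ M)
  ... | yes (c , c∈N̄─M) = c , x∈p─q⁻ (∁ N) M c∈N̄─M
  ... | no N̄─M-empty    = ⊥-elim (x∈p⇒x∉∁p e∈N (subst (e ∈_) (sym ∁N≡M) e∈M))
    where
    ∁N≡M : ∁ N ≡ M
    ∁N≡M = minimal-shrink minM (inj₁ ntN̄) (¬Nonempty[p─q]⇒p⊆q N̄─M-empty)

  overlapping-module : ∀ {M N} → IsMinimalCoModule T M → IsCoModule T N → Overlap T M N →
    ∃ λ V → IsModule T V × Overlap T M V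
  overlapping-module minM (inj₁ (mN , _)) ov = _ , mN , ov
  overlapping-module {M} {N} minM (inj₂ ntN̄) ov with overlap⁻ ov
  ... | a , b , _ , (a∈M , a∈N) , (b∈M , b∉N) , _ with ∁-escapes minM ntN̄ a∈M a∈N
  ...   | c , c∈N̄ , c∉M =
    ∁ N , proj₁ ntN̄ , overlap⁺ (b , a , c , (b∈M , x∉p⇒x∈∁p b∉N) , (a∈M , x∈p⇒x∉∁p a∈N) , (c∈N̄ , c∉M))

  -- If the minimal co-module M is a module overlapping a module V, then ∣M∣ = 2:
  -- M ∩ V and M ─ V are nonempty modules properly inside M, hence singletons.
  module-overlap⇒∣M∣≡2 : ∀ {M V} → IsMinimalCoModule T M → IsModule T M → IsModule T V →
    Overlap T M V → ∣ M ∣ ≡ 2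
  module-overlap⇒∣M∣≡2 {M} {V} minM mM mV ov with overlap⁻ ov
  ... | a , b , c , (a∈M , a∈V) , (b∈M , b∉V) , c∈V─M =
    trans (∣p∣≡∣p∩q∣+∣p─q∣ M V) (cong₂ _+_ ∣M∩V∣≡1 ∣M─V∣≡1)
    where
    ∣M∩V∣≡1 : ∣ M ∩ V ∣ ≡ 1
    ∣M∩V∣≡1 = proper-submodule-singleton minM (∩-module mM mV) (p∩q⊆p M V)
      (x∈p∩q⁺ (a∈M , a∈V)) b∈M (b∉V ∘ proj₂ ∘ x∈p∩q⁻ M V)
    ∣M─V∣≡1 : ∣ M ─ V ∣ ≡ 1
    ∣M─V∣≡1 = proper-submodule-singleton minM
      (─-module mM mV (c , x∈p∧x∉q⇒x∈p─q (proj₁ c∈V─M) (proj₂ c∈V─M))) (p─q⊆p M V)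
      (x∈p∧x∉q⇒x∈p─q b∈M b∉V) a∈M (λ a∈M─V → proj₂ (x∈p─q⁻ M V a∈M─V) a∈V)

  -- If instead ∁M is a nontrivial module, no module V overlaps M: U = V ∪ ∁M would be
  -- a nontrivial module, so ∁U = M ─ V would be a co-module strictly inside M.
  ∁module-overlap⇒⊥ : ∀ {M V} → IsMinimalCoModule T M → IsNontrivialModule T (∁ M) →
    IsModule T V → Overlap T M V → ⊥
  ∁module-overlap⇒⊥ {M} {V} minM (m∁M , nt∁M) mV ov with overlap⁻ ov
  ... | a , b , c , (a∈M , a∈V) , (b∈M , b∉V) , (c∈V , c∉M) =
    x∈∁p⇒x∉p (subst (a ∈_) (sym ∁U≡M) a∈M) (x∈p∪q⁺ (inj₁ a∈V))
    where
    U : Subset n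
    U = V ∪ ∁ M
    b∉U : b ∉ U
    b∉U b∈U with x∈p∪q⁻ V (∁ M) b∈U
    ... | inj₁ b∈V  = b∉V b∈V
    ... | inj₂ b∈∁M = x∈∁p⇒x∉p b∈∁M b∈M
    ntU : IsNontrivialModule T U
    ntU = ∪-module mV m∁M (c , x∈p∩q⁺ (c∈V , x∉p⇒x∈∁p c∉M))
        , ¬trivial (≤-trans (nontrivial⇒2≤∣A∣ nt∁M) (∣q∣≤∣p∪q∣ V (∁ M))) b∉U
    ∁U≡M : ∁ U ≡ M
    ∁U≡M = minimal-shrink minM (∁-coModule ntU)
      (λ x∈∁U → x∉∁p⇒x∈p (x∈∁p⇒x∉p x∈∁U ∘ x∈p∪q⁺ ∘ inj₂))

  overlap⇒pairModule : ∀ {M N} → IsMinimalCoModule T M → InO T M N → IsModule T M × ∣ M ∣ ≡ 2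
  overlap⇒pairModule minM ((coN , _) , ov) with overlapping-module minM coN ov | proj₁ minM
  ... | _ , mV , ovV | inj₁ (mM , _) = mM , module-overlap⇒∣M∣≡2 minM mM mV ovV
  ... | _ , mV , ovV | inj₂ nt∁M     = ⊥-elim (∁module-overlap⇒⊥ minM nt∁M mV ovV)

  -- Two distinct co-modules overlapping M share no vertex of M: together with M they
  -- would form a sunflower of two-vertex modules.
  shared-vertex⇒⊥ : ∀ {M N N′ a} → IsMinimalCoModule T M → N ≢ N′ → InO T M N → InO T M N′ →
    a ∈ M → a ∈ N → a ∈ N′ → ⊥
  shared-vertex⇒⊥ minM N≢N′ oN@(minN , ovN) oN′@(minN′ , ovN′) a∈M a∈N a∈N′
    with overlap⇒pairModule minM oN
       | overlap⇒pairModule minN (minM , overlap-sym ovN)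
       | overlap⇒pairModule minN′ (minM , overlap-sym ovN′)
  ... | mM , ∣M∣≡2 | mN , ∣N∣≡2 | mN′ , ∣N′∣≡2 =
    sunflower mM mN mN′ ∣M∣≡2 ∣N∣≡2 ∣N′∣≡2 a∈M a∈N a∈N′ (overlap⇒≢ ovN) (overlap⇒≢ ovN′) N≢N′

  -- o_T(M) ≤ 2: of three overlapping co-modules, two meet M in the same vertex,
  -- since M has only two vertices.
  at-most-two-overlaps : ∀ {M} → IsMinimalCoModule T M →
    (Ns : List (Subset n)) → Unique Ns → All (InO T M) Ns → length Ns ≤ 2
  at-most-two-overlaps minM []              _ _ = z≤n
  at-most-two-overlaps minM (_ ∷ [])        _ _ = s≤s z≤n
  at-most-two-overlaps minM (_ ∷ _ ∷ [])    _ _ = s≤s (s≤s z≤n)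
  at-most-two-overlaps minM (N₁ ∷ N₂ ∷ N₃ ∷ _)
    ((N₁≢N₂ ∷ N₁≢N₃ ∷ _) ∷ (N₂≢N₃ ∷ _) ∷ _) (o₁ ∷ o₂ ∷ o₃ ∷ _)
    with overlap⁻ (proj₂ o₁) | overlap⁻ (proj₂ o₂) | overlap⁻ (proj₂ o₃)
  ... | a₁ , _ , _ , (a₁∈M , a₁∈N₁) , _ | a₂ , _ , _ , (a₂∈M , a₂∈N₂) , _
      | a₃ , _ , _ , (a₃∈M , a₃∈N₃) , _
    with pigeonhole (proj₂ (overlap⇒pairModule minM o₁)) a₁∈M a₂∈M a₃∈M
  ... | inj₁ a₁≡a₂ =
    ⊥-elim (shared-vertex⇒⊥ minM N₁≢N₂ o₁ o₂ a₁∈M a₁∈N₁ (subst (_∈ N₂) (sym a₁≡a₂) a₂∈N₂))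
  ... | inj₂ (inj₁ a₁≡a₃) =
    ⊥-elim (shared-vertex⇒⊥ minM N₁≢N₃ o₁ o₃ a₁∈M a₁∈N₁ (subst (_∈ N₃) (sym a₁≡a₃) a₃∈N₃))
  ... | inj₂ (inj₂ a₂≡a₃) =
    ⊥-elim (shared-vertex⇒⊥ minM N₂≢N₃ o₂ o₃ a₂∈M a₂∈N₂ (subst (_∈ N₃) (sym a₂≡a₃) a₃∈N₃))

lemma3 : (T : Tournament) (M : Subset (Tournament.n T)) →
    IsMinimalCoModule T M →
    ((Ns : List (Subset (Tournament.n T))) → Unique Ns → All (InO T M) Ns → length Ns ≤ 2)
    × (¬ (IsModule T M × ∣ M ∣ ≡ 2) → ∀ N → ¬ InO T M N)
lemma3 T M minM =
  at-most-two-overlaps T minM ,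
  λ notPairModule N M-overlaps-N → notPairModule (overlap⇒pairModule T minM M-overlaps-N)
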